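{- Let $d\geq 2$, $k\geq 2$, $r\geq -1$ be integers and let $G$ be an $(r,k,d)$-tree. Let $\overline{aa'}$ be an edge of $G$ with $\xi_G(a,a')=\max\{\xi_G(b,b'):\overline{bb'}\text{ an edge of }G\}$. Then for every vertex $a_0\neq a$ of $G$, writing the unique chain in $G$ from $a_0$ to $a$ as the edges $\overline{a_ia_{i+1}}$, $i=0,\dots,s$, with $a_{s+1}=a$, the sequence $\big(\xi_G(a_i,a_{i+1})\big)_{i=0}^{s}$ is non-decreasing.
   Context: An $(r,k,d)$-graph is a graph $G$ with vertex set $\{1,\dots,k\}$ together with, for each edge $\overline{ab}$, values $\xi_G(a,b),\xi_G(b,a)\in\{ -1,\dots,r\}$ and $\eta_G(a,b),\eta_G(b,a)\in\{0,\dots,d-1\}$ such that $\xi_G(a,b)=\xi_G(b,a)$, $\eta_G(a,b)+\eta_G(b,a)\equiv 0\pmod d$, $\eta=0$ when $\xi=-1$, and $\eta\in\{1,\dots,d-1\}$ when $\xi\geq 0$. Proper: for all distinct vertices $a,b,c$ with $\overline{ab},\overline{ac},\overline{bc}$ edges: (1) if $\xi_G(a,b)=\xi_G(b,c)=-1$ then $\xi_G(a,c)=-1$; (2) if $\xi_G(a,b)<\xi_G(b,c)$ then $\xi_G(a,c)=\xi_G(b,c)$ and $\eta_G(a,c)=\eta_G(b,c)$; (3) if $0\leq\xi_G(a,b)=\xi_G(b,c)$ and $\eta_G(a,b)+\eta_G(b,c)\neq d$ then $\xi_G(a,c)=\xi_G(a,b)$ and $\eta_G(a,c)\equiv\eta_G(a,b)+\eta_G(b,c)\pmod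 d$; (4) if $0\leq\xi_G(a,b)=\xi_G(b,c)$ and $\eta_G(a,b)+\eta_G(b,c)=d$ then $\xi_G(a,c)<\xi_G(a,b)$. A chain of edges $\overline{a_0a_1},\dots,\overline{a_{s-1}a_s}$ with pairwise distinct vertices $a_0,\dots,a_s$ is potentially complete in $G$ if there is $0\leq u\leq s-1$ with (a) $\xi_G(a_0,a_1)\leq\dots\leq\xi_G(a_u,a_{u+1})\geq\dots\geq\xi_G(a_{s-1},a_s)$ with no two consecutive equalities in this chain of inequalities, and (b) whenever $\xi_G(a_{i-1},a_i)=\xi_G(a_i,a_{i+1})\geq 0$, $\eta_G(a_{i-1},a_i)+\eta_G(a_i,a_{i+1})\not\equiv 0\pmod d$. An $(r,k,d)$-tree is a proper $(r,k,d)$-graph containing no cycle such that any two vertices are joined by a unique chain and this chain is potentially complete. -}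

module Defs where

open import Data.Nat as ℕ using (ℕ; zero; suc; _+_)
import Data.Nat.Divisibility as ℕD
open import Data.Integer as ℤ using (ℤ; +_; -[1+_]; _-_)
import Data.Integer.Divisibility as ℤD
open import Data.Fin using (Fin)
open import Data.Bool using (Bool; true)
open import Data.Product using (Σ; _×_; ∃)
open import Relation.Binary.PropositionalEquality using (_≡_; _≢_)
open import Relation.Nullary using (¬_)

minus1 : ℤ
minus1 = -[1+ 0 ]

ModEq : ℕ → ℕ → ℕ → Set
ModEq d x y = (+ d) ℤD.∣ ((+ x) - (+ y))

-- An (r,k,d)-graph on vertex set Fin k (vertices 1..k are 0..k-1).
-- The (simple, undirected) edge relation is a symmetric irreflexive Bool-valued
-- function; ξ and η are given on all ordered pairs but only constrained on edges.
record RKDGraph (r : ℤ) (k d : ℕ) : Set where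
  field
    edge    : Fin k → Fin k → Bool
    ξ       : Fin k → Fin k → ℤ
    η       : Fin k → Fin k → ℕ
    edge-irrefl : ∀ a → ¬ (edge a a ≡ true)
    edge-sym    : ∀ a b → edge a b ≡ true → edge b a ≡ true
    ξ-lower : ∀ a b → edge a b ≡ true → minus1 ℤ.≤ ξ a b
    ξ-upper : ∀ a b → edge a b ≡ true → ξ a b ℤ.≤ r
    η-upper : ∀ a b → edge a b ≡ true → η a b ℕ.< d
    ξ-sym   : ∀ a b → edge a b ≡ true → ξ a b ≡ ξ b a
    η-anti  : ∀ a b → edge a b ≡ true → d ℕD.∣ (η a b + η b a)
    η-zero  : ∀ a b → edge a b ≡ true → ξ a b ≡ minus1 → η a b ≡ 0
    η-pos   : ∀ a b → edge a b ≡ true → + 0 ℤ.≤ ξ a b → 1 ℕ.≤ η a b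

module _ {r : ℤ} {k d : ℕ} (G : RKDGraph r k d) where
  open RKDGraph G

  Proper : Set
  Proper = ∀ a b c → a ≢ b → a ≢ c → b ≢ c →
    edge a b ≡ true → edge a c ≡ true → edge b c ≡ true →
      (ξ a b ≡ minus1 → ξ b c ≡ minus1 → ξ a c ≡ minus1)
    × (ξ a b ℤ.< ξ b c → ξ a c ≡ ξ b c × η a c ≡ η b c)
    × (+ 0 ℤ.≤ ξ a b → ξ a b ≡ ξ b c → η a b + η b c ≢ d →
         ξ a c ≡ ξ a b × ModEq d (η a c) (η a b + η b c))
    × (+ 0 ℤ.≤ ξ a b → ξ a b ≡ ξ b c → η a b + η b c ≡ d →
         ξ a c ℤ.< ξ a b)

  -- A chain of n ≥ 1 edges: vertices v 0, ..., v n (pairwise distinct),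
  -- with v i -- v (i+1) an edge for i < n.  Values of v beyond n are irrelevant.
  record Chain : Set where
    field
      len      : ℕ
      len-pos  : 1 ℕ.≤ len
      vtx      : ℕ → Fin k
      distinct : ∀ i j → i ℕ.≤ len → j ℕ.≤ len → vtx i ≡ vtx j → i ≡ j
      edges    : ∀ i → i ℕ.< len → edge (vtx i) (vtx (suc i)) ≡ true

  open Chain public

  ChainFromTo : Chain → Fin k → Fin k → Set
  ChainFromTo c a b = vtx c 0 ≡ a × vtx c (len c) ≡ b

  SameChain : Chain → Chain → Set
  SameChain c c' = len c ≡ len c' × (∀ i → i ℕ.≤ len c → vtx c i ≡ vtx c' i)

  ξc : Chain → ℕ → ℤ
  ξc c i = ξ (vtx c i) (vtx c (suc i))

  ηc : Chain → ℕ → ℕ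
  ηc c i = η (vtx c i) (vtx c (suc i))

  -- potentially complete chain (edges indexed 0..len-1; the peak u < len)
  PotentiallyComplete : Chain → Set
  PotentiallyComplete c = ∃ λ u → u ℕ.< len c
    × (∀ i → suc i ℕ.≤ u → ξc c i ℤ.≤ ξc c (suc i))
    × (∀ i → u ℕ.≤ i → suc i ℕ.< len c → ξc c (suc i) ℤ.≤ ξc c i)
    × (∀ i → suc (suc i) ℕ.< len c →
         ¬ (ξc c i ≡ ξc c (suc i) × ξc c (suc i) ≡ ξc c (suc (suc i))))
    × (∀ i → suc i ℕ.< len c → ξc c i ≡ ξc c (suc i) → + 0 ℤ.≤ ξc c i →
         ¬ (ModEq d (ηc c i + ηc c (suc i)) 0))

  record Cycle : Set where
    field
      clen      : ℕ
      clen-ge3  : 3 ℕ.≤ clen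
      cvtx      : ℕ → Fin k
      cdistinct : ∀ i j → i ℕ.< clen → j ℕ.< clen → cvtx i ≡ cvtx j → i ≡ j
      cedges    : ∀ i → suc i ℕ.< clen → edge (cvtx i) (cvtx (suc i)) ≡ true
      cclose    : edge (cvtx (clen ℕ.∸ 1)) (cvtx 0) ≡ true

  IsTree : Set
  IsTree = Proper
    × ¬ Cycle
    × (∀ a b → a ≢ b →
         Σ Chain (λ c → ChainFromTo c a b
           × (∀ c' → ChainFromTo c' a b → SameChain c c')
           × PotentiallyComplete c))

-- The vertex a' cannot be a (no loops) nor any vertex of the chain from a₀ to a before
-- the second-to-last one, since the edge a a' would then close a cycle. So either the
-- chain already ends with the edge a' a, or extending it by a' yields a chain ending
-- with a a'. That chain is potentially complete and its last edge carries the maximal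
-- value of ξ; past the peak its values descend to this maximum, so they are constant
-- there, and the chain (hence also its prefix) is non-decreasing.
module Submission where

open import Defs
open import Data.Nat as ℕ using (ℕ; suc; zero; _+_; _∸_; _≤_; _<_; z≤n; s≤s; s≤s⁻¹)
open import Data.Nat.Properties as ℕP using ()
open import Data.Integer as ℤ using (ℤ; +_)
open import Data.Integer.Properties as ℤP using ()
open import Data.Fin using (Fin)
open import Data.Fin.Properties using () renaming (_≟_ to _≟ᶠ_)
open import Data.Bool using (true)
open import Data.Product using (_×_; _,_; proj₁; proj₂)
open import Data.Sum as Sum using (_⊎_; inj₁; inj₂)
open import Data.Empty using (⊥-elim)
open import Function using (_∘_)
open import Relation.Nullary using (¬_; yes; no)
open import Relation.Binary using (tri<; tri≈; tri>)
open import Relation.Binary.PropositionalEquality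

antitone-from : (f : ℕ → ℤ) (u n : ℕ) →
  (∀ i → u ≤ i → suc i < n → f (suc i) ℤ.≤ f i) →
  ∀ {i j} → u ≤ i → i ≤ j → j < n → f j ℤ.≤ f i
antitone-from f u n step {j = zero} u≤i z≤n j<n = ℤP.≤-refl
antitone-from f u n step {i} {suc j} u≤i i≤1+j 1+j<n with ℕP.m≤n⇒m<n∨m≡n i≤1+j
... | inj₂ refl = ℤP.≤-refl
... | inj₁ (s≤s i≤j) = ℤP.≤-trans (step j (ℕP.≤-trans u≤i i≤j) 1+j<n)
                                  (antitone-from f u n step u≤i i≤j (ℕP.<⇒≤ 1+j<n))

module _ {r : ℤ} {k d : ℕ} (G : RKDGraph r k d) where
  open RKDGraph G

  Nondecreasing : Chain G → Set
  Nondecreasing c = ∀ i → suc i < len c → ξc G c i ℤ.≤ ξc G c (suc i)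

  ξc-cong : (c c' : Chain G) {n : ℕ} → (∀ i → i ≤ n → vtx c i ≡ vtx c' i) →
            ∀ {i} → i < n → ξc G c i ≡ ξc G c' i
  ξc-cong c c' same {i = i} i<n = cong₂ ξ (same i (ℕP.<⇒≤ i<n)) (same (suc i) i<n)

  ηc-cong : (c c' : Chain G) {n : ℕ} → (∀ i → i ≤ n → vtx c i ≡ vtx c' i) →
            ∀ {i} → i < n → ηc G c i ≡ ηc G c' i
  ηc-cong c c' same {i = i} i<n = cong₂ η (same i (ℕP.<⇒≤ i<n)) (same (suc i) i<n)

  PotentiallyComplete-resp-SameChain : (c c' : Chain G) → SameChain G c c' →
    PotentiallyComplete G c → PotentiallyComplete G c'
  PotentiallyComplete-resp-SameChain c c' (len≡ , same)
                                     (u , u<len , ascending , descending , noPlateau , noCancel) =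
    u , subst (u <_) len≡ u<len , ascending' , descending' , noPlateau' , noCancel'
    where
      back : ∀ {i} → i < len c' → i < len c
      back = subst (_ <_) (sym len≡)

      ξ≡ : ∀ {i} → i < len c' → ξc G c i ≡ ξc G c' i
      ξ≡ = ξc-cong c c' same ∘ back

      η≡ : ∀ {i} → i < len c' → ηc G c i ≡ ηc G c' i
      η≡ = ηc-cong c c' same ∘ back

      ascending' : ∀ i → suc i ≤ u → ξc G c' i ℤ.≤ ξc G c' (suc i)
      ascending' i 1+i≤u = subst₂ ℤ._≤_ (ξ≡ (ℕP.<⇒≤ 2+i≤len)) (ξ≡ 2+i≤len) (ascending i 1+i≤u)
        where
          2+i≤len : suc i < len c'
          2+i≤len = ℕP.≤-<-trans 1+i≤u (subst (u <_) len≡ u<len)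

      descending' : ∀ i → u ≤ i → suc i < len c' → ξc G c' (suc i) ℤ.≤ ξc G c' i
      descending' i u≤i 2+i≤len =
        subst₂ ℤ._≤_ (ξ≡ 2+i≤len) (ξ≡ (ℕP.<⇒≤ 2+i≤len)) (descending i u≤i (back 2+i≤len))

      noPlateau' : ∀ i → suc (suc i) < len c' →
        ¬ (ξc G c' i ≡ ξc G c' (suc i) × ξc G c' (suc i) ≡ ξc G c' (suc (suc i)))
      noPlateau' i 3+i≤len (e₁ , e₂) = noPlateau i (back 3+i≤len)
        ( trans (ξ≡ i<len) (trans e₁ (sym (ξ≡ 1+i<len)))
        , trans (ξ≡ 1+i<len) (trans e₂ (sym (ξ≡ 3+i≤len))) )
        where
          1+i<len : suc i < len c'
          1+i<len = ℕP.<⇒≤ 3+i≤len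
          i<len : i < len c'
          i<len = ℕP.<⇒≤ 1+i<len

      noCancel' : ∀ i → suc i < len c' → ξc G c' i ≡ ξc G c' (suc i) → + 0 ℤ.≤ ξc G c' i →
        ¬ (ModEq d (ηc G c' i + ηc G c' (suc i)) 0)
      noCancel' i 2+i≤len e nonneg cancel = noCancel i (back 2+i≤len)
        (trans (ξ≡ i<len) (trans e (sym (ξ≡ 2+i≤len))))
        (subst (+ 0 ℤ.≤_) (sym (ξ≡ i<len)) nonneg)
        (subst (λ x → ModEq d x 0) (sym (cong₂ _+_ (η≡ i<len) (η≡ 2+i≤len))) cancel)
        where
          i<len : i < len c'
          i<len = ℕP.<⇒≤ 2+i≤len

  tree⇒potentiallyComplete : IsTree G → ∀ {x y} → x ≢ y →
    (c : Chain G) → ChainFromTo G c x y → PotentiallyComplete G c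
  tree⇒potentiallyComplete (_ , _ , chains) x≢y c c-from-to with chains _ _ x≢y
  ... | t , _ , unique , t-complete =
    PotentiallyComplete-resp-SameChain t c (unique c c-from-to) t-complete

  lastMaximal⇒nondecreasing : (c : Chain G) → PotentiallyComplete G c →
    ∀ m → suc m ≡ len c → (∀ j → j < len c → ξc G c j ℤ.≤ ξc G c m) → Nondecreasing c
  lastMaximal⇒nondecreasing c (u , _ , ascending , descending , _) m 1+m≡len maximal i 2+i≤len
    with suc i ℕ.≤? u
  ... | yes 1+i≤u = ascending i 1+i≤u
  ... | no 1+i≰u = ℤP.≤-reflexive (trans (atMaximum i≥u (ℕP.<⇒≤ 2+i≤len))
                                         (sym (atMaximum (ℕP.m≤n⇒m≤1+n i≥u) 2+i≤len)))
    where
      i≥u : u ≤ i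
      i≥u = s≤s⁻¹ (ℕP.≰⇒> 1+i≰u)

      atMaximum : ∀ {j} → u ≤ j → j < len c → ξc G c j ≡ ξc G c m
      atMaximum u≤j j<len = ℤP.≤-antisym (maximal _ j<len)
        (antitone-from (ξc G c) u (len c) descending u≤j
          (s≤s⁻¹ (subst (_ <_) (sym 1+m≡len) j<len)) (subst (m <_) 1+m≡len (ℕP.n<1+n m)))

  chord⇒cycle : (c : Chain G) (j : ℕ) → suc j < len c →
    edge (vtx c (len c)) (vtx c j) ≡ true → Cycle G
  chord⇒cycle c j 2+j≤len chord = record
    { clen      = suc (len c ∸ j)
    ; clen-ge3  = s≤s (ℕP.m+n≤o⇒m≤o∸n 2 2+j≤len)
    ; cvtx      = λ i → vtx c (i + j)
    ; cdistinct = λ i i' i< i'< eq → ℕP.+-cancelʳ-≡ j i i'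
                    (distinct c (i + j) (i' + j) (onChain i<) (onChain i'<) eq)
    ; cedges    = λ i 2+i≤ → edges c (i + j) (onChain 2+i≤)
    ; cclose    = subst (λ n → edge (vtx c n) (vtx c j) ≡ true)
                    (sym (ℕP.m∸n+n≡m j≤len)) chord
    }
    where
      j≤len : j ≤ len c
      j≤len = ℕP.<⇒≤ (ℕP.<⇒≤ 2+j≤len)

      onChain : ∀ {i} → i < suc (len c ∸ j) → i + j ≤ len c
      onChain i< = ℕP.m≤o∸n⇒m+n≤o _ j≤len (s≤s⁻¹ i<)

  nondecreasing-prefix : (c c' : Chain G) → len c ≤ len c' →
    (∀ i → i ≤ len c → vtx c i ≡ vtx c' i) → Nondecreasing c' → Nondecreasing c
  nondecreasing-prefix c c' len≤ same mono i 2+i≤len =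
    subst₂ ℤ._≤_ (sym (ξc-cong c c' same (ℕP.<⇒≤ 2+i≤len))) (sym (ξc-cong c c' same 2+i≤len))
      (mono i (ℕP.≤-trans 2+i≤len len≤))

  module Snoc (c : Chain G) (b : Fin k) (lastEdge : edge (vtx c (len c)) b ≡ true)
              (fresh : ∀ j → j ≤ len c → vtx c j ≢ b) where

    vtx⁺ : ℕ → Fin k
    vtx⁺ i with i ℕ.≤? len c
    ... | yes _ = vtx c i
    ... | no _  = b

    vtx⁺-old : ∀ i → i ≤ len c → vtx⁺ i ≡ vtx c i
    vtx⁺-old i i≤len with i ℕ.≤? len c
    ... | yes _   = refl
    ... | no i≰len = ⊥-elim (i≰len i≤len)

    vtx⁺-new : vtx⁺ (suc (len c)) ≡ b
    vtx⁺-new with suc (len c) ℕ.≤? len c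
    ... | yes 1+len≤len = ⊥-elim (ℕP.1+n≰n 1+len≤len)
    ... | no _          = refl

    old-or-new : ∀ {i} → i ≤ suc (len c) → i ≤ len c ⊎ i ≡ suc (len c)
    old-or-new = Sum.map₁ s≤s⁻¹ ∘ ℕP.m≤n⇒m<n∨m≡n

    snoc : Chain G
    snoc = record
      { len      = suc (len c)
      ; len-pos  = s≤s z≤n
      ; vtx      = vtx⁺
      ; distinct = distinct⁺
      ; edges    = edges⁺
      }
      where
        distinct⁺ : ∀ i j → i ≤ suc (len c) → j ≤ suc (len c) → vtx⁺ i ≡ vtx⁺ j → i ≡ j
        distinct⁺ i j i≤ j≤ eq with old-or-new i≤ | old-or-new j≤
        ... | inj₁ i≤len | inj₁ j≤len = distinct c i j i≤len j≤len
                (trans (sym (vtx⁺-old i i≤len)) (trans eq (vtx⁺-old j j≤len)))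
        ... | inj₁ i≤len | inj₂ refl = ⊥-elim (fresh i i≤len
                (trans (sym (vtx⁺-old i i≤len)) (trans eq vtx⁺-new)))
        ... | inj₂ refl | inj₁ j≤len = ⊥-elim (fresh j j≤len
                (trans (sym (vtx⁺-old j j≤len)) (trans (sym eq) vtx⁺-new)))
        ... | inj₂ refl | inj₂ refl = refl

        edges⁺ : ∀ i → i < suc (len c) → edge (vtx⁺ i) (vtx⁺ (suc i)) ≡ true
        edges⁺ i 1+i≤ with old-or-new 1+i≤
        ... | inj₁ 1+i≤len rewrite vtx⁺-old i (ℕP.<⇒≤ 1+i≤len) | vtx⁺-old (suc i) 1+i≤len =
              edges c i 1+i≤len
        ... | inj₂ refl rewrite vtx⁺-old (len c) ℕP.≤-refl | vtx⁺-new = lastEdge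

  module _ (tree : IsTree G) {a a' : Fin k} (aa' : edge a a' ≡ true)
           (maximal : ∀ b b' → edge b b' ≡ true → ξ b b' ℤ.≤ ξ a a') where

    endsAtMaximum⇒nondecreasing : ∀ {x y} → x ≢ y → (c : Chain G) → ChainFromTo G c x y →
      ∀ m → suc m ≡ len c → ξc G c m ≡ ξ a a' → Nondecreasing c
    endsAtMaximum⇒nondecreasing x≢y c c-from-to m 1+m≡len ξm≡max =
      lastMaximal⇒nondecreasing c (tree⇒potentiallyComplete tree x≢y c c-from-to) m 1+m≡len
        (λ j j<len → subst (ξc G c j ℤ.≤_) (sym ξm≡max) (maximal _ _ (edges c j j<len)))

    chainTowardsMaximalEdge⇒nondecreasing : ∀ {a₀} → a₀ ≢ a →
      (c : Chain G) → ChainFromTo G c a₀ a → Nondecreasing c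
    chainTowardsMaximalEdge⇒nondecreasing {a₀} a₀≢a c (from-a₀ , to-a)
      with ℕP.anyUpTo? (λ j → vtx c j ≟ᶠ a') (suc (len c))
    ... | no a'∉c =
      nondecreasing-prefix c snoc (ℕP.n≤1+n _) (λ i → sym ∘ vtx⁺-old i)
        (endsAtMaximum⇒nondecreasing a₀≢a' snoc (trans (vtx⁺-old 0 z≤n) from-a₀ , vtx⁺-new)
          (len c) refl (cong₂ ξ (trans (vtx⁺-old (len c) ℕP.≤-refl) to-a) vtx⁺-new))
      where
        open Snoc c a' (subst (λ x → edge x a' ≡ true) (sym to-a) aa')
                       (λ j j≤len vj≡a' → a'∉c (j , s≤s j≤len , vj≡a'))
        a₀≢a' : a₀ ≢ a'
        a₀≢a' a₀≡a' = a'∉c (0 , s≤s z≤n , trans from-a₀ a₀≡a')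
    ... | yes (j , j<1+len , vj≡a') with ℕP.<-cmp (suc j) (len c)
    ...   | tri< 2+j≤len _ _ = ⊥-elim (acyclic (chord⇒cycle c j 2+j≤len
              (subst₂ (λ x y → edge x y ≡ true) (sym to-a) (sym vj≡a') aa')))
      where
        acyclic : ¬ Cycle G
        acyclic = proj₁ (proj₂ tree)
    ...   | tri≈ _ 1+j≡len _ = endsAtMaximum⇒nondecreasing a₀≢a c (from-a₀ , to-a) j 1+j≡len
              (trans (cong₂ ξ vj≡a' (trans (cong (vtx c) 1+j≡len) to-a)) (sym (ξ-sym a a' aa')))
    ...   | tri> _ _ len<1+j = ⊥-elim (edge-irrefl a (subst (λ x → edge a x ≡ true) a'≡a aa'))
      where
        a'≡a : a' ≡ a
        a'≡a = trans (sym vj≡a')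
          (trans (cong (vtx c) (ℕP.≤-antisym (s≤s⁻¹ j<1+len) (s≤s⁻¹ len<1+j))) to-a)

lemma2p13 : (r : ℤ) (k d : ℕ) → 2 ℕ.≤ d → 2 ℕ.≤ k → minus1 ℤ.≤ r →
    (G : RKDGraph r k d) → IsTree G →
    (a a' : Fin k) → RKDGraph.edge G a a' ≡ true →
    (∀ b b' → RKDGraph.edge G b b' ≡ true → RKDGraph.ξ G b b' ℤ.≤ RKDGraph.ξ G a a') →
    (a₀ : Fin k) → a₀ ≢ a →
    (c : Chain G) → ChainFromTo G c a₀ a →
    ∀ i → suc i ℕ.< Chain.len c → ξc G c i ℤ.≤ ξc G c (suc i)
lemma2p13 r k d _ _ _ G tree a a' aa' maximal a₀ a₀≢a =
  chainTowardsMaximalEdge⇒nondecreasing G tree aa' maximal a₀≢a
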